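{- Let $\Gamma$ be a finite group, $H$ a generating set for $\Gamma$, $G=\mathrm{Cay}(\Gamma,H)$, and activation threshold $t=|H|$. Let $S\subseteq\Gamma$ be the set of initially active vertices. Then $G$ can be synchronized from $S$ if and only if the subdigraph $G\setminus S$ induced on $\Gamma\setminus S$ contains no directed cycle.
   Context: The Cayley digraph $\mathrm{Cay}(\Gamma,H)$ has vertex set $\Gamma$ and an edge from $x$ to $y$ whenever $y=hx$ for some $h\in H$ (a loop if $1\in H$, which counts as a cycle of length 1). Activation process: given a digraph with vertex set $V$, a set $S\subseteq V$ and threshold $t$, put $S_0=S$ and $S_i=S_{i-1}\cup\{v\notin S_{i-1}: v \text{ has at least } t \text{ edges } (u,v) \text{ with } u\in S_{i-1}\}$ for $i\ge1$; the digraph is synchronized from $S$ if $S_i=V$ for some $i$. -}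

module Defs where

open import Data.Nat using (ℕ; zero; suc; _≤ᵇ_)
open import Data.Bool using (Bool; true; false; _∧_; _∨_)
open import Data.Fin using (Fin; zero; suc; inject₁; fromℕ)
open import Data.Fin.Properties using (any?)
open import Data.Fin.Subset using (Subset; _∈_; _∉_; ∣_∣; ⊤)
open import Data.Fin.Subset.Properties using (_∈?_)
open import Data.Vec using (tabulate)
open import Data.Product using (∃; ∃-syntax; _×_; _,_)
open import Relation.Binary.PropositionalEquality using (_≡_)
open import Relation.Nullary using (Dec; yes; no; ¬_)
open import Relation.Nullary.Decidable using (⌊_⌋; _×-dec_)
open import Algebra.Core using (Op₁; Op₂)
open import Algebra.Structures using (IsGroup)
open import Function.Definitions using (Injective)
open import Data.Fin using (_≟_)

-- A finite group, presented (up to isomorphism) on the carrier Fin order.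
record FinGroup : Set where
  field
    order   : ℕ
    _∙_     : Op₂ (Fin order)
    ε       : Fin order
    _⁻¹     : Op₁ (Fin order)
    isGroup : IsGroup _≡_ _∙_ ε _⁻¹

module _ (Γ : FinGroup) where
  open FinGroup Γ

  data Generated (H : Subset order) : Fin order → Set where
    gen  : ∀ {h} → h ∈ H → Generated H h
    unit : Generated H ε
    mul  : ∀ {x y} → Generated H x → Generated H y → Generated H (x ∙ y)
    inv  : ∀ {x} → Generated H x → Generated H (x ⁻¹)

  IsGeneratingSet : Subset order → Set
  IsGeneratingSet H = ∀ g → Generated H g

  Edge : Subset order → Fin order → Fin order → Set
  Edge H x y = ∃[ h ] (h ∈ H × y ≡ h ∙ x)

  edge? : (H : Subset order) → ∀ x y → Dec (Edge H x y)
  edge? H x y = any? (λ h → (h ∈? H) ×-dec (y ≟ (h ∙ x)))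

  activeInNbrs : Subset order → Subset order → Fin order → Subset order
  activeInNbrs H S v = tabulate (λ u → ⌊ u ∈? S ⌋ ∧ ⌊ edge? H u v ⌋)

  step : Subset order → ℕ → Subset order → Subset order
  step H t S = tabulate (λ v → ⌊ v ∈? S ⌋ ∨ (t ≤ᵇ ∣ activeInNbrs H S v ∣))

  stage : Subset order → ℕ → Subset order → ℕ → Subset order
  stage H t S zero    = S
  stage H t S (suc i) = step H t (stage H t S i)

  Synchronized : Subset order → ℕ → Subset order → Set
  Synchronized H t S = ∃[ i ] (stage H t S i ≡ ⊤)

  -- a directed cycle of length k+1 (k = 0: a loop) with distinct vertices f 0,…,f k
  record DirectedCycle (H : Subset order) (S : Subset order) : Set where
    field
      len-1    : ℕ
      vertex   : Fin (suc len-1) → Fin order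
      distinct : Injective _≡_ _≡_ vertex
      outside  : ∀ i → vertex i ∉ S
      edges    : ∀ (i : Fin len-1) → Edge H (vertex (inject₁ i)) (vertex (suc i))
      closing  : Edge H (vertex (fromℕ len-1)) (vertex zero)

  Acyclic-outside : Subset order → Subset order → Set
  Acyclic-outside H S = ¬ DirectedCycle H S

{-# OPTIONS --safe #-}
module Submission where

-- The edges into v are h⁻¹v → v for h ∈ H, and h ↦ h⁻¹v is a permutation of Γ, so every vertex has
-- in-degree ∣H∣: with threshold ∣H∣ a vertex is activated exactly when all its in-neighbours are
-- active. Hence no vertex of a directed cycle avoiding S is ever activated. Conversely, a vertex still
-- inactive after ∣Γ∣ rounds had an inactive in-neighbour in the previous round, and so on back to
-- round 0; this backward walk of length ∣Γ∣ avoids S, and its first repeated vertex closes a cycle.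

open import Defs
open import Data.Fin.Subset using (Subset; ∣_∣)
open import Data.Product using (_×_)

open import Level using (0ℓ)
open import Data.Bool using (Bool; true; false; T; if_then_else_)
open import Data.Bool.Properties using (T-≡; T-∧; T-∨)
open import Data.Fin using (Fin; zero; suc; toℕ; inject₁; fromℕ; fromℕ<; _≟_)
open import Data.Fin.Permutation using (Permutation′; permutation; _⟨$⟩ʳ_)
open import Data.Fin.Properties using (any?; injective⇒≤; toℕ-injective; toℕ<n; toℕ≤pred[n]; toℕ-inject₁; toℕ-fromℕ; toℕ-fromℕ<)
open import Data.Fin.Subset using (_∈_; _∉_; _⊆_; _∩_; ⊤)
open import Data.Fin.Subset.Properties using (_∈?_; ∈⊤; ⊆-antisym; x∈p∩q⁺; x∈p∩q⁻; p∩q⊆p; p⊆q⇒∣p∣≤∣q∣; p⊂q⇒∣p∣<∣q∣)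
open import Data.Nat using (ℕ; zero; suc; _≤_; _<_; _∸_; s≤s)
open import Data.Nat.Properties using (m<n⇒m<1+n; ≤ᵇ⇒≤; ≤⇒≤ᵇ; <⇒≱; n<1+n; m<1+n⇒m<n∨m≡n; m∸n≤m; ∸-cancelˡ-≡; m∸[m∸n]≡n; +-∸-assoc; ≤-trans; ≤-<-trans; <-≤-trans; +-0-commutativeMonoid)
open import Data.Product as Product using (∃-syntax; _,_; proj₂)
open import Data.Sum as Sum using (_⊎_; inj₁; inj₂)
open import Data.Vec using (lookup; tabulate)
open import Data.Vec.Properties using (lookup∘tabulate; tabulate∘lookup; []=⇒lookup; lookup⇒[]=)
open import Function using (_∘_; _⇔_; mk⇔; Equivalence)
open import Relation.Nullary using (yes; no; ¬?; contradiction)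
open import Relation.Nullary.Decidable using (toWitness; fromWitness; decidable-stable; _×-dec_)
open import Relation.Binary.PropositionalEquality using (_≡_; _≢_; refl; sym; trans; cong; subst; module ≡-Reasoning)
open import Algebra.Bundles using (Group)
import Algebra.Properties.Group as GroupProperties
open import Algebra.Properties.CommutativeMonoid.Sum +-0-commutativeMonoid using (sum; sum-permute)

open Equivalence using (to; from)

∈-tabulate : ∀ {n} {f : Fin n → Bool} {i : Fin n} → i ∈ tabulate f ⇔ T (f i)
∈-tabulate {f = f} {i} = mk⇔
  (λ i∈ → from T-≡ (trans (sym (lookup∘tabulate f i)) ([]=⇒lookup i∈)))
  (λ Tfi → lookup⇒[]= i _ (trans (lookup∘tabulate f i) (to T-≡ Tfi)))

∣tabulate∣≡∑ : ∀ {n} (f : Fin n → Bool) → ∣ tabulate f ∣ ≡ sum (λ i → if f i then 1 else 0)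
∣tabulate∣≡∑ {zero} f = refl
∣tabulate∣≡∑ {suc n} f with f zero
... | true  = cong suc (∣tabulate∣≡∑ (f ∘ suc))
... | false = ∣tabulate∣≡∑ (f ∘ suc)

preimage : ∀ {m n} → (Fin m → Fin n) → Subset n → Subset m
preimage g p = tabulate (lookup p ∘ g)

∈-preimage : ∀ {m n} {g : Fin m → Fin n} {p : Subset n} {i : Fin m} → i ∈ preimage g p ⇔ g i ∈ p
∈-preimage {g = g} {p} {i} = mk⇔
  (λ i∈ → lookup⇒[]= (g i) p (trans (sym (lookup∘tabulate (lookup p ∘ g) i)) ([]=⇒lookup i∈)))
  (λ gi∈ → lookup⇒[]= i _ (trans (lookup∘tabulate (lookup p ∘ g) i) ([]=⇒lookup gi∈)))

∣preimage∣≡∣p∣ : ∀ {n} (π : Permutation′ n) (p : Subset n) → ∣ preimage (π ⟨$⟩ʳ_) p ∣ ≡ ∣ p ∣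
∣preimage∣≡∣p∣ π p = begin
  ∣ tabulate (lookup p ∘ (π ⟨$⟩ʳ_)) ∣              ≡⟨ ∣tabulate∣≡∑ (lookup p ∘ (π ⟨$⟩ʳ_)) ⟩
  sum (λ i → if lookup p (π ⟨$⟩ʳ i) then 1 else 0) ≡⟨ sum-permute (λ i → if lookup p i then 1 else 0) π ⟨
  sum (λ i → if lookup p i then 1 else 0)          ≡⟨ ∣tabulate∣≡∑ (lookup p) ⟨
  ∣ tabulate (lookup p) ∣                          ≡⟨ cong ∣_∣ (tabulate∘lookup p) ⟩
  ∣ p ∣                                            ∎
  where open ≡-Reasoning

module _ {n : ℕ} (w : ℕ → Fin n) where

  InjectiveBelow : ℕ → Set
  InjectiveBelow k = ∀ {a b} → a < k → b < k → w a ≡ w b → a ≡ b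

  record FirstRepetitionBelow (k : ℕ) : Set where
    field
      {i j}     : ℕ
      i<j       : i < j
      j<k       : j < k
      repeat    : w i ≡ w j
      injective : InjectiveBelow j

  injectiveBelow-suc : ∀ {k} → InjectiveBelow k → (∀ (i : Fin k) → w (toℕ i) ≢ w k) → InjectiveBelow (suc k)
  injectiveBelow-suc {k} inj fresh a<1+k b<1+k wa≡wb
    with m<1+n⇒m<n∨m≡n a<1+k | m<1+n⇒m<n∨m≡n b<1+k
  ... | inj₁ a<k  | inj₁ b<k  = inj a<k b<k wa≡wb
  ... | inj₂ refl | inj₂ refl = refl
  ... | inj₁ a<k  | inj₂ refl = contradiction (trans (cong w (toℕ-fromℕ< a<k)) wa≡wb) (fresh (fromℕ< a<k))
  ... | inj₂ refl | inj₁ b<k  = contradiction (trans (cong w (toℕ-fromℕ< b<k)) (sym wa≡wb)) (fresh (fromℕ< b<k))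

  firstRepetitionBelow⊎injectiveBelow : ∀ k → FirstRepetitionBelow k ⊎ InjectiveBelow k
  firstRepetitionBelow⊎injectiveBelow zero = inj₂ (λ ())
  firstRepetitionBelow⊎injectiveBelow (suc k) with firstRepetitionBelow⊎injectiveBelow k
  ... | inj₁ r = inj₁ (record { i<j = i<j ; j<k = m<n⇒m<1+n j<k ; repeat = repeat ; injective = injective })
    where open FirstRepetitionBelow r
  ... | inj₂ inj with any? (λ (i : Fin k) → w (toℕ i) ≟ w k)
  ...   | yes (i , wi≡wk) = inj₁ (record { i<j = toℕ<n i ; j<k = n<1+n k ; repeat = wi≡wk ; injective = inj })
  ...   | no ¬repeat      = inj₂ (injectiveBelow-suc inj (λ i wi≡wk → ¬repeat (i , wi≡wk)))

  firstRepetition : FirstRepetitionBelow (suc n)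
  firstRepetition with firstRepetitionBelow⊎injectiveBelow (suc n)
  ... | inj₁ r   = r
  ... | inj₂ inj = contradiction (injective⇒≤ (toℕ-injective ∘ inj (toℕ<n _) (toℕ<n _))) (<⇒≱ (n<1+n n))

module _ {a ℓ} (G : Group a ℓ) where
  open Group G
  open GroupProperties G using (\\-leftDividesˡ; \\-leftDividesʳ; //-rightDividesˡ; //-rightDividesʳ)
  open import Relation.Binary.Reasoning.Setoid setoid

  [x//y]\\x≈y : ∀ x y → (x // y) \\ x ≈ y
  [x//y]\\x≈y x y = begin
    (x // y) \\ x              ≈⟨ ∙-congˡ (//-rightDividesˡ y x) ⟨
    (x // y) \\ ((x // y) ∙ y) ≈⟨ \\-leftDividesʳ (x // y) y ⟩
    y                          ∎

  x//[y\\x]≈y : ∀ x y → x // (y \\ x) ≈ y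
  x//[y\\x]≈y x y = begin
    x // (y \\ x)              ≈⟨ ∙-congʳ (\\-leftDividesˡ y x) ⟨
    (y ∙ (y \\ x)) // (y \\ x) ≈⟨ //-rightDividesʳ (y \\ x) y ⟩
    y                          ∎

module Cayley (Γ : FinGroup) (H : Subset (FinGroup.order Γ)) where
  open FinGroup Γ

  group : Group 0ℓ 0ℓ
  group = record { isGroup = isGroup }

  open Group group using (_\\_; _//_)
  open GroupProperties group using (//-rightDividesˡ; //-rightDividesʳ)

  ∈-activeInNbrs : ∀ {T v u} → u ∈ activeInNbrs Γ H T v ⇔ (u ∈ T × Edge Γ H u v)
  ∈-activeInNbrs {T} {v} {u} = mk⇔
    (Product.map (toWitness {a? = u ∈? T}) (toWitness {a? = edge? Γ H u v}) ∘ to T-∧ ∘ to ∈-tabulate)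
    (from ∈-tabulate ∘ from T-∧ ∘ Product.map (fromWitness {a? = u ∈? T}) (fromWitness {a? = edge? Γ H u v}))

  ∈-step : ∀ {t T v} → v ∈ step Γ H t T ⇔ (v ∈ T ⊎ t ≤ ∣ activeInNbrs Γ H T v ∣)
  ∈-step {t} {T} {v} = mk⇔
    (Sum.map (toWitness {a? = v ∈? T}) (≤ᵇ⇒≤ t _) ∘ to T-∨ ∘ to ∈-tabulate)
    (from ∈-tabulate ∘ from T-∨ ∘ Sum.map (fromWitness {a? = v ∈? T}) ≤⇒≤ᵇ)

  inNbr : Fin order → Permutation′ order
  inNbr v = permutation (_\\ v) (v //_) ([x//y]\\x≈y group v) (x//[y\\x]≈y group v)

  Edge⇔//∈H : ∀ {u v} → Edge Γ H u v ⇔ v // u ∈ H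
  Edge⇔//∈H {u} {v} = mk⇔
    (λ (h , h∈H , v≡h∙u) → subst (_∈ H) (sym (trans (cong (_// u) v≡h∙u) (//-rightDividesʳ u h))) h∈H)
    (λ v//u∈H → v // u , v//u∈H , sym (//-rightDividesˡ u v))

  Edge-\\⇔∈H : ∀ {h v} → Edge Γ H (h \\ v) v ⇔ h ∈ H
  Edge-\\⇔∈H {h} {v} = mk⇔
    (subst (_∈ H) (x//[y\\x]≈y group v h) ∘ to Edge⇔//∈H)
    (from Edge⇔//∈H ∘ subst (_∈ H) (sym (x//[y\\x]≈y group v h)))

  preimage-activeInNbrs : ∀ {T v} → preimage (_\\ v) (activeInNbrs Γ H T v) ≡ H ∩ preimage (_\\ v) T
  preimage-activeInNbrs {T} {v} = ⊆-antisym
    (λ h∈ → let (∈T , edge) = to ∈-activeInNbrs (to ∈-preimage h∈) in x∈p∩q⁺ (to Edge-\\⇔∈H edge , from ∈-preimage ∈T))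
    (λ h∈ → let (∈H , ∈T) = x∈p∩q⁻ H _ h∈ in from ∈-preimage (from ∈-activeInNbrs (to ∈-preimage ∈T , from Edge-\\⇔∈H ∈H)))

  ∣activeInNbrs∣≡∣H∩preimage∣ : ∀ {T v} → ∣ activeInNbrs Γ H T v ∣ ≡ ∣ H ∩ preimage (_\\ v) T ∣
  ∣activeInNbrs∣≡∣H∩preimage∣ {T} {v} = begin
    ∣ activeInNbrs Γ H T v ∣                  ≡⟨ ∣preimage∣≡∣p∣ (inNbr v) (activeInNbrs Γ H T v) ⟨
    ∣ preimage (_\\ v) (activeInNbrs Γ H T v) ∣ ≡⟨ cong ∣_∣ (preimage-activeInNbrs {T} {v}) ⟩
    ∣ H ∩ preimage (_\\ v) T ∣                 ∎
    where open ≡-Reasoning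

  ∣activeInNbrs∣<∣H∣ : ∀ {T u v} → u ∉ T → Edge Γ H u v → ∣ activeInNbrs Γ H T v ∣ < ∣ H ∣
  ∣activeInNbrs∣<∣H∣ {T} {u} {v} u∉T u→v = subst (_< ∣ H ∣) (sym ∣activeInNbrs∣≡∣H∩preimage∣)
    (p⊂q⇒∣p∣<∣q∣ (p∩q⊆p H _ , v // u , to Edge⇔//∈H u→v , v//u∉preimage ∘ proj₂ ∘ x∈p∩q⁻ H _))
    where
    v//u∉preimage : v // u ∉ preimage (_\\ v) T
    v//u∉preimage = u∉T ∘ subst (_∈ T) ([x//y]\\x≈y group v u) ∘ to ∈-preimage

  ∣H∣≤∣activeInNbrs∣ : ∀ {T v} → (∀ {u} → Edge Γ H u v → u ∈ T) → ∣ H ∣ ≤ ∣ activeInNbrs Γ H T v ∣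
  ∣H∣≤∣activeInNbrs∣ inNbrs⊆T = subst (∣ H ∣ ≤_) (sym ∣activeInNbrs∣≡∣H∩preimage∣)
    (p⊆q⇒∣p∣≤∣q∣ (λ h∈H → x∈p∩q⁺ (h∈H , from ∈-preimage (inNbrs⊆T (from Edge-\\⇔∈H h∈H)))))

  inNbrs⊆⇒∈step : ∀ {T v} → (∀ {u} → Edge Γ H u v → u ∈ T) → v ∈ step Γ H ∣ H ∣ T
  inNbrs⊆⇒∈step inNbrs⊆T = from ∈-step (inj₂ (∣H∣≤∣activeInNbrs∣ inNbrs⊆T))

  inactiveInNbr⇒∉step : ∀ {T u v} → v ∉ T → u ∉ T → Edge Γ H u v → v ∉ step Γ H ∣ H ∣ T
  inactiveInNbr⇒∉step v∉T u∉T u→v v∈ with to ∈-step v∈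
  ... | inj₁ v∈T = v∉T v∈T
  ... | inj₂ ∣H∣≤ = <⇒≱ (∣activeInNbrs∣<∣H∣ u∉T u→v) ∣H∣≤

  ∉step⇒inactiveInNbr : ∀ {T v} → v ∉ step Γ H ∣ H ∣ T → ∃[ u ] (u ∉ T × Edge Γ H u v)
  ∉step⇒inactiveInNbr {T} {v} v∉ with any? (λ u → ¬? (u ∈? T) ×-dec edge? Γ H u v)
  ... | yes inactiveInNbr = inactiveInNbr
  ... | no ¬inactiveInNbr = contradiction (inNbrs⊆⇒∈step inNbrs⊆T) v∉
    where
    inNbrs⊆T : ∀ {u} → Edge Γ H u v → u ∈ T
    inNbrs⊆T {u} u→v = decidable-stable (u ∈? T) (λ u∉T → ¬inactiveInNbr (u , u∉T , u→v))

  ⊆-step : ∀ {t T} → T ⊆ step Γ H t T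
  ⊆-step {t} = from (∈-step {t}) ∘ inj₁

  ⊆-stage : ∀ {t S} k → S ⊆ stage Γ H t S k
  ⊆-stage zero    = λ v∈S → v∈S
  ⊆-stage {t} (suc k) = ⊆-step {t} ∘ ⊆-stage k

  module _ {S : Subset order} (C : DirectedCycle Γ H S) where
    open DirectedCycle C

    predecessor : ∀ k → ∃[ p ] Edge Γ H (vertex p) (vertex k)
    predecessor zero    = fromℕ len-1 , closing
    predecessor (suc k) = inject₁ k , edges k

    cycle-∉stage : ∀ j k → vertex k ∉ stage Γ H ∣ H ∣ S j
    cycle-∉stage zero    k = outside k
    cycle-∉stage (suc j) k =
      let (p , p→k) = predecessor k in inactiveInNbr⇒∉step (cycle-∉stage j k) (cycle-∉stage j p) p→k

  synchronized⇒acyclic : ∀ {S} → Synchronized Γ H ∣ H ∣ S → Acyclic-outside Γ H S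
  synchronized⇒acyclic (i , Sᵢ≡⊤) C = cycle-∉stage C i zero (subst (_ ∈_) (sym Sᵢ≡⊤) ∈⊤)

  record BackwardWalk (S : Subset order) (k : ℕ) (v : Fin order) : Set where
    field
      vertex  : ℕ → Fin order
      start   : vertex 0 ≡ v
      outside : ∀ m → vertex m ∉ S
      edge    : ∀ {m} → m < k → Edge Γ H (vertex (suc m)) (vertex m)

  inactiveWalk : ∀ {S} k {v} → v ∉ stage Γ H ∣ H ∣ S k → BackwardWalk S k v
  inactiveWalk zero {v} v∉S = record
    { vertex = λ _ → v ; start = refl ; outside = λ _ → v∉S ; edge = λ () }
  inactiveWalk {S} (suc k) {v} v∉ with ∉step⇒inactiveInNbr v∉
  ... | u , u∉ , u→v = record
    { vertex  = λ { zero → v ; (suc m) → vertex m }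
    ; start   = refl
    ; outside = λ { zero → v∉ ∘ ⊆-stage (suc k) ; (suc m) → outside m }
    ; edge    = λ { {zero} _ → subst (λ x → Edge Γ H x v) (sym start) u→v ; {suc m} (s≤s m<k) → edge m<k }
    }
    where open BackwardWalk (inactiveWalk k u∉)

  -- The walk runs against the edges, so the cycle visits vertex j, vertex (j ∸ 1), …, vertex i.
  repetition⇒cycle : ∀ {S k v} (W : BackwardWalk S k v) → let open BackwardWalk W in
                     ∀ {i j} → i ≤ j → j < k → vertex i ≡ vertex (suc j) → InjectiveBelow vertex (suc j) →
                     DirectedCycle Γ H S
  repetition⇒cycle W {i} {j} i≤j j<k repeat injective = record
    { len-1    = j ∸ i
    ; vertex   = cycleVertex
    ; distinct = distinct
    ; outside  = λ x → outside (j ∸ toℕ x)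
    ; edges    = edges
    ; closing  = closing
    }
    where
    open BackwardWalk W
    cycleVertex : Fin (suc (j ∸ i)) → Fin order
    cycleVertex x = vertex (j ∸ toℕ x)

    toℕ≤j : ∀ (x : Fin (suc (j ∸ i))) → toℕ x ≤ j
    toℕ≤j x = ≤-trans (toℕ≤pred[n] x) (m∸n≤m j i)

    distinct : ∀ {x y} → cycleVertex x ≡ cycleVertex y → x ≡ y
    distinct {x} {y} eq = toℕ-injective (∸-cancelˡ-≡ (toℕ≤j x) (toℕ≤j y)
      (injective (s≤s (m∸n≤m j (toℕ x))) (s≤s (m∸n≤m j (toℕ y))) eq))

    edges : ∀ (x : Fin (j ∸ i)) → Edge Γ H (cycleVertex (inject₁ x)) (cycleVertex (suc x))
    edges x = subst (λ m → Edge Γ H (vertex m) (vertex (j ∸ suc (toℕ x)))) (sym j∸x≡1+j∸[1+x])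
                (edge (≤-<-trans (m∸n≤m j (suc (toℕ x))) j<k))
      where
      j∸x≡1+j∸[1+x] : j ∸ toℕ (inject₁ x) ≡ suc (j ∸ suc (toℕ x))
      j∸x≡1+j∸[1+x] = trans (cong (j ∸_) (toℕ-inject₁ x))
                        (+-∸-assoc 1 (<-≤-trans (toℕ<n x) (m∸n≤m j i)))

    closing : Edge Γ H (cycleVertex (fromℕ (j ∸ i))) (cycleVertex zero)
    closing = subst (λ x → Edge Γ H x (vertex j)) (sym lastVertex) (edge j<k)
      where
      lastVertex : cycleVertex (fromℕ (j ∸ i)) ≡ vertex (suc j)
      lastVertex = trans (cong (λ m → vertex (j ∸ m)) (toℕ-fromℕ (j ∸ i)))
                     (trans (cong vertex (m∸[m∸n]≡n i≤j)) repeat)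

  inactive⇒cycle : ∀ {S v} → v ∉ stage Γ H ∣ H ∣ S order → DirectedCycle Γ H S
  inactive⇒cycle v∉ with firstRepetition (BackwardWalk.vertex (inactiveWalk order v∉))
  ... | record { i<j = s≤s i≤j ; j<k = s≤s j<n ; repeat = repeat ; injective = injective } =
    repetition⇒cycle (inactiveWalk order v∉) i≤j j<n repeat injective

  acyclic⇒synchronized : ∀ {S} → Acyclic-outside Γ H S → Synchronized Γ H ∣ H ∣ S
  acyclic⇒synchronized {S} acyclic = order , ⊆-antisym (λ _ → ∈⊤) (λ {v} _ → activated v)
    where
    activated : ∀ v → v ∈ stage Γ H ∣ H ∣ S order
    activated v = decidable-stable (v ∈? _) (acyclic ∘ inactive⇒cycle)

corollary1 : (Γ : FinGroup) (H S : Subset (FinGroup.order Γ)) → IsGeneratingSet Γ H → (Synchronized Γ H ∣ H ∣ S → Acyclic-outside Γ H S) × (Acyclic-outside Γ H S → Synchronized Γ H ∣ H ∣ S)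
corollary1 Γ H S _ = synchronized⇒acyclic , acyclic⇒synchronized
  where open Cayley Γ H
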